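{- For $n\in\mathbb{N}$ let $H_n(A,B)$ be the bipartite graph with $A=[2^n]\times[n]$ and $B=[n]$ in which $(a,a')\in A$ is adjacent to $b\in B$ if and only if the $b$-th bit of $a$ written in binary is $1$. Let $p$ and $\ell$ be integers. Then $H_n(A,B)$ is $\ell$-universal whenever $n\ge\ell$, and the probability that a $p$-tuple of vertices of $H_n$, chosen independently and uniformly at random, consists of $p$ distinct vertices of $A$ whose $\ell$-shadow is the multiset containing each vector of $\{0,1\}^p$ with multiplicity exactly $\ell$ tends to one as $n$ tends to infinity.
   Context: $[k]=\{1,\dots,k\}$. For a bipartite graph $G(A,B)$ the adjacency matrix has rows indexed by $A$ and columns by $B$. $G(A,B)$ is $\ell$-universal if every vector of $\{0,1\}^B$ appears at least $\ell$ times among the rows of its adjacency matrix. For a vertex set $W$, with $W_A=W\cap A$, $W_B=W\cap B$, the $\ell$-shadow of $W$ is the multiset containing each $u\in\{0,1\}^{W_A}$ exactly $\min\{k,\ell\}$ times, where $k$ is the number of vertices $b\in B\setminus W_B$ whose column restricted to the rows $W_A$ equals $u$. For a $p$-tuple of distinct vertices of $A$, vectors in $\{0,1\}^{W_A}$ are identified with $\{0,1\}^p$ via the order of the tuple. -}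

module Defs where

open import Data.Nat using (ℕ; zero; suc; _+_; _*_; _^_; _≡ᵇ_; _⊓_)
open import Data.Nat.DivMod using (_/_; _%_)
open import Data.Bool using (Bool; true; false; _∧_; not; if_then_else_)
open import Data.Fin using (Fin; toℕ)
open import Data.List using (List; []; _∷_; map; _++_; length; concatMap; cartesianProduct; allFin)
open import Data.Vec using (Vec; []; _∷_; toList)
open import Data.Product using (_×_; _,_)
open import Data.Sum using (_⊎_; inj₁; inj₂)
open import Data.Maybe using (Maybe; just; nothing)
open import Data.Bool.ListAction using (all; any)

countL : {X : Set} → (X → Bool) → List X → ℕ
countL f []       = 0
countL f (x ∷ xs) = if f x then suc (countL f xs) else countL f xs

eqB : Bool → Bool → Bool
eqB true  y = y
eqB false y = not y

allTuples : {X : Set} → List X → (p : ℕ) → List (Vec X p)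
allTuples xs zero    = [] ∷ []
allTuples xs (suc p) = concatMap (λ x → map (x ∷_) (allTuples xs p)) xs

bools : List Bool
bools = true ∷ false ∷ []

-- bit b of a written in binary (b = 0 is the least significant bit)
bit : ℕ → ℕ → Bool
bit a zero    = (a % 2) ≡ᵇ 1
bit a (suc b) = bit (a / 2) b

-- A = [2^n] × [n],  B = [n]   (encoded 0-based with Fin)
VA : ℕ → Set
VA n = Fin (2 ^ n) × Fin n

VB : ℕ → Set
VB n = Fin n

V : ℕ → Set
V n = VA n ⊎ VB n

adj : {n : ℕ} → VA n → VB n → Bool
adj (a , _) b = bit (toℕ a) (toℕ b)

allVA : (n : ℕ) → List (VA n)
allVA n = cartesianProduct (allFin (2 ^ n)) (allFin n)

allVB : (n : ℕ) → List (VB n)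
allVB n = allFin n

allV : (n : ℕ) → List (V n)
allV n = map inj₁ (allVA n) ++ map inj₂ (allVB n)

-- ℓ-universality: every vector of {0,1}^B occurs at least ℓ times
-- among the rows of the adjacency matrix

rowEquals : {n : ℕ} → VA n → (VB n → Bool) → Bool
rowEquals {n} a v = all (λ b → eqB (adj a b) (v b)) (allVB n)

rowMultiplicity : (n : ℕ) → (VB n → Bool) → ℕ
rowMultiplicity n v = countL (λ a → rowEquals a v) (allVA n)

Universal : (n ℓ : ℕ) → Set
Universal n ℓ = (v : VB n → Bool) → ℓ Data.Nat.≤ rowMultiplicity n v

-- Here W_A is the set of the tuple's vertices and W_B = ∅, so
-- B ∖ W_B = B.  Vectors of {0,1}^{W_A} are identified with {0,1}^p
-- (Vec Bool p) via the order of the tuple.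

columnMatches : {n p : ℕ} → Vec (VA n) p → Vec Bool p → VB n → Bool
columnMatches []      []      b = true
columnMatches (a ∷ t) (x ∷ u) b = eqB (adj a b) x ∧ columnMatches t u b

shadowMult : {n p : ℕ} → ℕ → Vec (VA n) p → Vec Bool p → ℕ
shadowMult {n} ℓ t u = countL (columnMatches t u) (allVB n) ⊓ ℓ

shadowIsFull : {n p : ℕ} → ℕ → Vec (VA n) p → Bool
shadowIsFull {n} {p} ℓ t = all (λ u → shadowMult ℓ t u ≡ᵇ ℓ) (allTuples bools p)

eqVA : {n : ℕ} → VA n → VA n → Bool
eqVA (a , a') (c , c') = (toℕ a ≡ᵇ toℕ c) ∧ (toℕ a' ≡ᵇ toℕ c')

distinctA : {n p : ℕ} → Vec (VA n) p → Bool
distinctA []      = true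
distinctA (a ∷ t) = not (any (eqVA a) (toList t)) ∧ distinctA t

inA : {n p : ℕ} → Vec (V n) p → Maybe (Vec (VA n) p)
inA []            = just []
inA (inj₂ _ ∷ t)  = nothing
inA (inj₁ a ∷ t) with inA t
... | just s  = just (a ∷ s)
... | nothing = nothing

goodTuple : {n p : ℕ} → ℕ → Vec (V n) p → Bool
goodTuple ℓ t with inA t
... | just s  = distinctA s ∧ shadowIsFull ℓ s
... | nothing = false

totalTuples : (n p : ℕ) → ℕ
totalTuples n p = length (allTuples (allV n) p)

goodTuples : (n p ℓ : ℕ) → ℕ
goodTuples n p ℓ = countL (goodTuple ℓ) (allTuples (allV n) p)

module Submission where

-- Universality: for v ∈ {0,1}^B let a < 2^n be the number with binary digits
-- v; the n rows (a , a'), a' ∈ [n], all equal v, so v occurs n ≥ ℓ times.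
--
-- Almost all tuples are good: a p-tuple that is not good is either
-- degenerate (an entry in B, or a repeated entry) or defective (in A^p, but
-- some u ∈ {0,1}^p occurs as fewer than ℓ columns).  By induction on p the
-- degenerate tuples are a proportion at most p (n + p) / |V(H_n)|.  Whether a
-- tuple of A is defective depends only on the first coordinates a_i < 2^n;
-- splitting off their lowest bits shows that, for each u, the number of
-- (a_i) ∈ [2^n]^p with fewer than ℓ columns equal to u obeys the recursion of
-- the binomial tail Σ_{i<ℓ} C(n,i) (2^p - 1)^(n-i), which is o(2^(pn)).  A
-- union bound over u gives o(2^p n^p 2^(pn)) = o(|V(H_n)|^p) defective tuples.

open import Defs
open import Data.Nat using (ℕ; zero; suc; _+_; _*_; _^_; _∸_; _≤_; _<_; z≤n; s≤s; _<ᵇ_; _≡ᵇ_; _⊓_; pred; >-nonZero)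
open import Data.Nat.Properties
open import Data.Nat.DivMod using (_/_; _%_; [m+kn]%n≡m%n; +-distrib-/-∣ʳ; m*n/n≡m)
open import Data.Nat.Divisibility using (divides)
open import Data.Nat.Tactic.RingSolver using (solve-∀)
open import Algebra.Properties.CommutativeSemigroup +-commutativeSemigroup using (interchange; xy∙z≈xz∙y; x∙yz≈xz∙y)
open import Data.Bool using (Bool; true; false; _∧_; _∨_; not; if_then_else_)
open import Data.Bool.ListAction using (all; any)
open import Data.Fin using (Fin; toℕ; fromℕ<) renaming (zero to fzero; suc to fsuc)
open import Data.Fin.Properties using (toℕ-fromℕ<)
open import Data.List using (List; []; _∷_; map; _++_; length; concatMap; cartesianProduct; allFin; tabulate)
open import Data.List.Properties using (length-++; length-map)
open import Data.List.Membership.Propositional using (_∈_)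
open import Data.List.Membership.Propositional.Properties using (∈-allFin)
open import Data.List.Relation.Unary.Any using (here; there)
open import Data.Maybe using (just; nothing; maybe′)
open import Data.Vec using (Vec; []; _∷_; toList)
import Data.Vec as Vec
open import Data.Product using (_×_; _,_; proj₁; proj₂; ∃-syntax)
open import Data.Sum using (inj₁; inj₂)
open import Function using (_∘_)
open import Relation.Binary.PropositionalEquality

ind : Bool → ℕ
ind true  = 1
ind false = 0

ind≤1 : ∀ c → ind c ≤ 1
ind≤1 true  = s≤s z≤n
ind≤1 false = z≤n

sumL : {X : Set} → (X → ℕ) → List X → ℕ
sumL f []       = 0
sumL f (x ∷ xs) = f x + sumL f xs

module _ {X : Set} where

  countL≡sumL : (f : X → Bool) (xs : List X) → countL f xs ≡ sumL (ind ∘ f) xs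
  countL≡sumL f [] = refl
  countL≡sumL f (x ∷ xs) with f x
  ... | true  = cong suc (countL≡sumL f xs)
  ... | false = countL≡sumL f xs

  length≡sumL : (xs : List X) → length xs ≡ sumL (λ _ → 1) xs
  length≡sumL []       = refl
  length≡sumL (x ∷ xs) = cong suc (length≡sumL xs)

  sumL-cong : {f g : X → ℕ} → (∀ x → f x ≡ g x) → (xs : List X) → sumL f xs ≡ sumL g xs
  sumL-cong e []       = refl
  sumL-cong e (x ∷ xs) = cong₂ _+_ (e x) (sumL-cong e xs)

  sumL-mono : {f g : X → ℕ} → (∀ x → f x ≤ g x) → (xs : List X) → sumL f xs ≤ sumL g xs
  sumL-mono e []       = z≤n
  sumL-mono e (x ∷ xs) = +-mono-≤ (e x) (sumL-mono e xs)

  sumL-++ : (f : X → ℕ) (xs ys : List X) → sumL f (xs ++ ys) ≡ sumL f xs + sumL f ys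
  sumL-++ f []       ys = refl
  sumL-++ f (x ∷ xs) ys = trans (cong (f x +_) (sumL-++ f xs ys)) (sym (+-assoc (f x) _ _))

  sumL-+ : (f g : X → ℕ) (xs : List X) → sumL (λ x → f x + g x) xs ≡ sumL f xs + sumL g xs
  sumL-+ f g []       = refl
  sumL-+ f g (x ∷ xs) = trans (cong (f x + g x +_) (sumL-+ f g xs)) (interchange (f x) (g x) _ _)

  sumL-* : (c : ℕ) (f : X → ℕ) (xs : List X) → sumL (λ x → c * f x) xs ≡ c * sumL f xs
  sumL-* c f []       = sym (*-zeroʳ c)
  sumL-* c f (x ∷ xs) = trans (cong (c * f x +_) (sumL-* c f xs)) (sym (*-distribˡ-+ c (f x) _))

  sumL-const : (c : ℕ) (xs : List X) → sumL (λ _ → c) xs ≡ length xs * c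
  sumL-const c []       = refl
  sumL-const c (x ∷ xs) = cong (c +_) (sumL-const c xs)

  sumL-zero : (xs : List X) → sumL (λ _ → 0) xs ≡ 0
  sumL-zero xs = trans (sumL-const 0 xs) (*-zeroʳ (length xs))

  term≤sumL : (f : X → ℕ) {x : X} {xs : List X} → x ∈ xs → f x ≤ sumL f xs
  term≤sumL f {xs = y ∷ xs} (here refl) = m≤m+n (f y) _
  term≤sumL f {xs = y ∷ xs} (there x∈xs) = ≤-trans (term≤sumL f x∈xs) (m≤n+m _ (f y))

sumL-map : {X Y : Set} (f : Y → ℕ) (g : X → Y) (xs : List X) → sumL f (map g xs) ≡ sumL (f ∘ g) xs
sumL-map f g []       = refl
sumL-map f g (x ∷ xs) = cong (f (g x) +_) (sumL-map f g xs)

module _ {X Y : Set} where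

  sumL-swap : (F : X → Y → ℕ) (xs : List X) (ys : List Y) →
    sumL (λ x → sumL (F x) ys) xs ≡ sumL (λ y → sumL (λ x → F x y) xs) ys
  sumL-swap F []       ys = sym (sumL-zero ys)
  sumL-swap F (x ∷ xs) ys =
    trans (cong (sumL (F x) ys +_) (sumL-swap F xs ys)) (sym (sumL-+ (F x) _ ys))

  sumL-concatMap : (f : Y → ℕ) (g : X → List Y) (xs : List X) →
    sumL f (concatMap g xs) ≡ sumL (λ x → sumL f (g x)) xs
  sumL-concatMap f g []       = refl
  sumL-concatMap f g (x ∷ xs) =
    trans (sumL-++ f (g x) _) (cong (sumL f (g x) +_) (sumL-concatMap f g xs))

  sumL-cartesianProduct : (f : X × Y → ℕ) (xs : List X) (ys : List Y) →
    sumL f (cartesianProduct xs ys) ≡ sumL (λ x → sumL (λ y → f (x , y)) ys) xs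
  sumL-cartesianProduct f []       ys = refl
  sumL-cartesianProduct f (x ∷ xs) ys =
    trans (sumL-++ f (map (x ,_) ys) _)
          (cong₂ _+_ (sumL-map f (x ,_) ys) (sumL-cartesianProduct f xs ys))

sumL-allTuples : {X : Set} (xs : List X) (p : ℕ) (f : Vec X (suc p) → ℕ) →
  sumL f (allTuples xs (suc p)) ≡ sumL (λ x → sumL (f ∘ (x ∷_)) (allTuples xs p)) xs
sumL-allTuples xs p f =
  trans (sumL-concatMap f _ xs) (sumL-cong (λ x → sumL-map f (x ∷_) (allTuples xs p)) xs)

length-allTuples : {X : Set} (xs : List X) (p : ℕ) → length (allTuples xs p) ≡ length xs ^ p
length-allTuples xs zero    = refl
length-allTuples xs (suc p) = begin
  length (allTuples xs (suc p))                        ≡⟨ length≡sumL (allTuples xs (suc p)) ⟩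
  sumL (λ _ → 1) (allTuples xs (suc p))                ≡⟨ sumL-allTuples xs p _ ⟩
  sumL (λ _ → sumL (λ _ → 1) (allTuples xs p)) xs      ≡⟨ sumL-cong (λ _ → sym (length≡sumL (allTuples xs p))) xs ⟩
  sumL (λ _ → length (allTuples xs p)) xs              ≡⟨ sumL-const _ xs ⟩
  length xs * length (allTuples xs p)                  ≡⟨ cong (length xs *_) (length-allTuples xs p) ⟩
  length xs ^ suc p                                    ∎
  where open ≡-Reasoning

sumN : ℕ → (ℕ → ℕ) → ℕ
sumN zero    f = 0
sumN (suc m) f = f 0 + sumN m (f ∘ suc)

sumL-tabulate : {X : Set} (m : ℕ) (f : X → ℕ) (h : Fin m → X) (F : ℕ → ℕ) →
  (∀ i → f (h i) ≡ F (toℕ i)) → sumL f (tabulate h) ≡ sumN m F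
sumL-tabulate zero    f h F e = refl
sumL-tabulate (suc m) f h F e =
  cong₂ _+_ (e fzero) (sumL-tabulate m f (h ∘ fsuc) (F ∘ suc) (e ∘ fsuc))

sumL-allFin : (m : ℕ) (F : ℕ → ℕ) → sumL (F ∘ toℕ) (allFin m) ≡ sumN m F
sumL-allFin m F = sumL-tabulate m (F ∘ toℕ) (λ i → i) F (λ _ → refl)

sumN-cong : (m : ℕ) {f g : ℕ → ℕ} → (∀ x → f x ≡ g x) → sumN m f ≡ sumN m g
sumN-cong zero    e = refl
sumN-cong (suc m) e = cong₂ _+_ (e 0) (sumN-cong m (e ∘ suc))

sumN-+ : (m : ℕ) (f g : ℕ → ℕ) → sumN m (λ x → f x + g x) ≡ sumN m f + sumN m g
sumN-+ zero    f g = refl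
sumN-+ (suc m) f g =
  trans (cong (f 0 + g 0 +_) (sumN-+ m (f ∘ suc) (g ∘ suc))) (interchange (f 0) (g 0) _ _)

sumN-* : (m c : ℕ) (f : ℕ → ℕ) → sumN m (λ x → c * f x) ≡ c * sumN m f
sumN-* zero    c f = sym (*-zeroʳ c)
sumN-* (suc m) c f = trans (cong (c * f 0 +_) (sumN-* m c (f ∘ suc))) (sym (*-distribˡ-+ c (f 0) _))

sumN-const : (m c : ℕ) → sumN m (λ _ → c) ≡ m * c
sumN-const zero    c = refl
sumN-const (suc m) c = cong (c +_) (sumN-const m c)

length-allFin : (m : ℕ) → length (allFin m) ≡ m
length-allFin m =
  trans (length≡sumL (allFin m)) (trans (sumL-allFin m (λ _ → 1)) (trans (sumN-const m 1) (*-identityʳ m)))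

sumN-≡ᵇ≤1 : ∀ m k → sumN m (λ i → ind (i ≡ᵇ k)) ≤ 1
sumN-≡ᵇ≤1 zero    k       = z≤n
sumN-≡ᵇ≤1 (suc m) zero    = s≤s (≤-reflexive (trans (sumN-const m 0) (*-zeroʳ m)))
sumN-≡ᵇ≤1 (suc m) (suc k) = sumN-≡ᵇ≤1 m k

-- Binary digits

pushBit : Bool → ℕ → ℕ
pushBit c a = ind c + a * 2

bit-pushBit-zero : ∀ c a → bit (pushBit c a) 0 ≡ c
bit-pushBit-zero c a = trans (cong (_≡ᵇ 1) ([m+kn]%n≡m%n (ind c) a 2)) (parity c)
  where
  parity : ∀ c → (ind c % 2 ≡ᵇ 1) ≡ c
  parity true  = refl
  parity false = refl

bit-pushBit-suc : ∀ c a b → bit (pushBit c a) (suc b) ≡ bit a b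
bit-pushBit-suc c a b = cong (λ x → bit x b) half
  where
  ind/2 : ∀ c → ind c / 2 ≡ 0
  ind/2 true  = refl
  ind/2 false = refl
  half : pushBit c a / 2 ≡ a
  half = trans (+-distrib-/-∣ʳ (ind c) (divides a refl)) (cong₂ _+_ (ind/2 c) (m*n/n≡m a 2))

pushBit-< : ∀ c {a m} → a < m → pushBit c a < m * 2
pushBit-< c {a} {m} a<m = begin-strict
  ind c + a * 2 ≤⟨ +-monoˡ-≤ (a * 2) (ind≤1 c) ⟩
  1 + a * 2     <⟨ n<1+n (1 + a * 2) ⟩
  suc a * 2     ≤⟨ *-monoˡ-≤ 2 a<m ⟩
  m * 2         ∎
  where open ≤-Reasoning

sumN-double : (m : ℕ) (f : ℕ → ℕ) → sumN (m * 2) f ≡ sumN m (λ a → f (pushBit false a) + f (pushBit true a))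
sumN-double zero    f = refl
sumN-double (suc m) f =
  trans (sym (+-assoc (f 0) (f 1) _)) (cong (f 0 + f 1 +_) (sumN-double m (f ∘ suc ∘ suc)))

2^[1+n]≡2^n*2 : ∀ n → 2 ^ suc n ≡ 2 ^ n * 2
2^[1+n]≡2^n*2 n = *-comm 2 (2 ^ n)

encode : (n : ℕ) → (Fin n → Bool) → ℕ
encode zero    v = 0
encode (suc n) v = pushBit (v fzero) (encode n (v ∘ fsuc))

encode-< : ∀ n v → encode n v < 2 ^ n
encode-< zero    v = s≤s z≤n
encode-< (suc n) v =
  subst (encode (suc n) v <_) (sym (2^[1+n]≡2^n*2 n)) (pushBit-< (v fzero) (encode-< n (v ∘ fsuc)))

bit-encode : ∀ n v (i : Fin n) → bit (encode n v) (toℕ i) ≡ v i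
bit-encode (suc n) v fzero    = bit-pushBit-zero (v fzero) (encode n (v ∘ fsuc))
bit-encode (suc n) v (fsuc i) = trans (bit-pushBit-suc (v fzero) _ (toℕ i)) (bit-encode n (v ∘ fsuc) i)

all-tabulate : {X : Set} {m : ℕ} (f : X → Bool) (h : Fin m → X) →
  (∀ i → f (h i) ≡ true) → all f (tabulate h) ≡ true
all-tabulate {m = zero}  f h e = refl
all-tabulate {m = suc m} f h e rewrite e fzero = all-tabulate f (h ∘ fsuc) (e ∘ fsuc)

eqB-refl : ∀ x → eqB x x ≡ true
eqB-refl true  = refl
eqB-refl false = refl

n≤rowMultiplicity : ∀ n v → n ≤ rowMultiplicity n v
n≤rowMultiplicity n v = begin
  n                                                 ≡⟨ sym (*-identityʳ n) ⟩
  n * 1                                             ≡⟨ cong (λ b → n * ind b) (sym a*-matches) ⟩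
  n * ind (matchesRow a*)                           ≤⟨ term≤sumL (λ a → n * ind (matchesRow a)) (∈-allFin a*) ⟩
  sumL (λ a → n * ind (matchesRow a)) (allFin (2 ^ n))
    ≡⟨ sumL-cong (λ a → trans (cong (_* ind (matchesRow a)) (sym (length-allFin n)))
                              (sym (sumL-const _ (allFin n)))) (allFin (2 ^ n)) ⟩
  sumL (λ a → sumL (λ a' → ind (rowEquals (a , a') v)) (allFin n)) (allFin (2 ^ n))
    ≡⟨ sym (sumL-cartesianProduct _ (allFin (2 ^ n)) (allFin n)) ⟩
  sumL (λ a → ind (rowEquals a v)) (allVA n)        ≡⟨ sym (countL≡sumL _ (allVA n)) ⟩
  rowMultiplicity n v                               ∎
  where
  open ≤-Reasoning
  -- rows of (a , a') do not depend on a'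
  matchesRow : Fin (2 ^ n) → Bool
  matchesRow a = all (λ b → eqB (bit (toℕ a) (toℕ b)) (v b)) (allFin n)
  a* : Fin (2 ^ n)
  a* = fromℕ< (encode-< n v)
  a*-matches : matchesRow a* ≡ true
  a*-matches = all-tabulate _ (λ i → i) λ i →
    trans (cong (λ x → eqB (bit x (toℕ i)) (v i)) (toℕ-fromℕ< (encode-< n v)))
    (trans (cong (λ x → eqB x (v i)) (bit-encode n v i)) (eqB-refl (v i)))

-- Counting integer tuples by their binary columns.
-- For as ∈ [0, 2^n)^p and u ∈ {0,1}^p, "column b of as is u" means that
-- bit b of the i-th entry of as is u_i for every i.

sumBelow : (p m : ℕ) → (Vec ℕ p → ℕ) → ℕ
sumBelow zero    m H = H []
sumBelow (suc p) m H = sumN m (λ a → sumBelow p m (H ∘ (a ∷_)))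

sumBits : (p : ℕ) → (Vec Bool p → ℕ) → ℕ
sumBits zero    H = H []
sumBits (suc p) H = sumBits p (H ∘ (false ∷_)) + sumBits p (H ∘ (true ∷_))

sumBelow-cong : (p m : ℕ) {F G : Vec ℕ p → ℕ} → (∀ v → F v ≡ G v) → sumBelow p m F ≡ sumBelow p m G
sumBelow-cong zero    m e = e []
sumBelow-cong (suc p) m e = sumN-cong m (λ a → sumBelow-cong p m (e ∘ (a ∷_)))

sumBelow-+ : (p m : ℕ) (F G : Vec ℕ p → ℕ) → sumBelow p m (λ v → F v + G v) ≡ sumBelow p m F + sumBelow p m G
sumBelow-+ zero    m F G = refl
sumBelow-+ (suc p) m F G = trans (sumN-cong m (λ a → sumBelow-+ p m _ _)) (sumN-+ m _ _)

sumBelow-* : (p m c : ℕ) (F : Vec ℕ p → ℕ) → sumBelow p m (λ v → c * F v) ≡ c * sumBelow p m F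
sumBelow-* zero    m c F = refl
sumBelow-* (suc p) m c F = trans (sumN-cong m (λ a → sumBelow-* p m c _)) (sumN-* m c _)

sumBelow-zero : (p m : ℕ) → sumBelow p m (λ _ → 0) ≡ 0
sumBelow-zero zero    m = refl
sumBelow-zero (suc p) m = trans (sumN-cong m (λ _ → sumBelow-zero p m)) (trans (sumN-const m 0) (*-zeroʳ m))

sumBelow-one : (p : ℕ) (F : Vec ℕ p → ℕ) → sumBelow p 1 F ≡ F (Vec.replicate p 0)
sumBelow-one zero    F = refl
sumBelow-one (suc p) F = trans (+-identityʳ _) (sumBelow-one p (F ∘ (0 ∷_)))

sumBits-cong : (p : ℕ) {F G : Vec Bool p → ℕ} → (∀ v → F v ≡ G v) → sumBits p F ≡ sumBits p G
sumBits-cong zero    e = e []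
sumBits-cong (suc p) e = cong₂ _+_ (sumBits-cong p (e ∘ (false ∷_))) (sumBits-cong p (e ∘ (true ∷_)))

sumBits-const : (p c : ℕ) → sumBits p (λ _ → c) ≡ 2 ^ p * c
sumBits-const zero    c = sym (+-identityʳ c)
sumBits-const (suc p) c =
  trans (cong₂ _+_ (sumBits-const p c) (sumBits-const p c)) (double (2 ^ p) c)
  where
  double : ∀ K c → K * c + K * c ≡ 2 * K * c
  double = solve-∀

pushBits : {p : ℕ} → Vec Bool p → Vec ℕ p → Vec ℕ p
pushBits = Vec.zipWith pushBit

-- each a < 2m is pushBit c a' for exactly one c and a' < m
sumBelow-double : (p m : ℕ) (H : Vec ℕ p → ℕ) →
  sumBelow p (m * 2) H ≡ sumBelow p m (λ as → sumBits p (λ cs → H (pushBits cs as)))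
sumBelow-double zero    m H = refl
sumBelow-double (suc p) m H = begin
  sumN (m * 2) (λ a → sumBelow p (m * 2) (H ∘ (a ∷_)))
    ≡⟨ sumN-double m _ ⟩
  sumN m (λ a → sumBelow p (m * 2) (H ∘ (pushBit false a ∷_)) + sumBelow p (m * 2) (H ∘ (pushBit true a ∷_)))
    ≡⟨ sumN-cong m (λ a → cong₂ _+_ (sumBelow-double p m _) (sumBelow-double p m _)) ⟩
  sumN m (λ a → sumBelow p m (λ as → sumBits p (λ cs → H (pushBit false a ∷ pushBits cs as)))
              + sumBelow p m (λ as → sumBits p (λ cs → H (pushBit true a ∷ pushBits cs as))))
    ≡⟨ sumN-cong m (λ a → sym (sumBelow-+ p m _ _)) ⟩
  sumBelow (suc p) m (λ as → sumBits (suc p) (λ cs → H (pushBits cs as))) ∎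
  where open ≡-Reasoning

eqBits : {p : ℕ} → Vec Bool p → Vec Bool p → Bool
eqBits []       []       = true
eqBits (c ∷ cs) (x ∷ u) = eqB c x ∧ eqBits cs u

columnIs : {p : ℕ} → Vec ℕ p → Vec Bool p → ℕ → Bool
columnIs []       []      b = true
columnIs (a ∷ as) (x ∷ u) b = eqB (bit a b) x ∧ columnIs as u b

matches : {p : ℕ} → ℕ → Vec ℕ p → Vec Bool p → ℕ
matches n as u = sumN n (λ b → ind (columnIs as u b))

columnIs-pushBits-zero : {p : ℕ} (cs : Vec Bool p) (as : Vec ℕ p) (u : Vec Bool p) →
  columnIs (pushBits cs as) u 0 ≡ eqBits cs u
columnIs-pushBits-zero []       []       []      = refl
columnIs-pushBits-zero (c ∷ cs) (a ∷ as) (x ∷ u) =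
  cong₂ (λ y z → eqB y x ∧ z) (bit-pushBit-zero c a) (columnIs-pushBits-zero cs as u)

columnIs-pushBits-suc : {p : ℕ} (cs : Vec Bool p) (as : Vec ℕ p) (u : Vec Bool p) (b : ℕ) →
  columnIs (pushBits cs as) u (suc b) ≡ columnIs as u b
columnIs-pushBits-suc []       []       []      b = refl
columnIs-pushBits-suc (c ∷ cs) (a ∷ as) (x ∷ u) b =
  cong₂ (λ y z → eqB y x ∧ z) (bit-pushBit-suc c a b) (columnIs-pushBits-suc cs as u b)

matches-pushBits : {p : ℕ} (n : ℕ) (cs : Vec Bool p) (as : Vec ℕ p) (u : Vec Bool p) →
  matches (suc n) (pushBits cs as) u ≡ ind (eqBits cs u) + matches n as u
matches-pushBits n cs as u =
  cong₂ _+_ (cong ind (columnIs-pushBits-zero cs as u))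
            (sumN-cong n (λ b → cong ind (columnIs-pushBits-suc cs as u b)))

-- among the 2^p bit vectors exactly one equals u
sumBits-select : (p : ℕ) (u : Vec Bool p) (X Y : ℕ) →
  sumBits p (λ cs → if eqBits cs u then X else Y) + Y ≡ X + 2 ^ p * Y
sumBits-select zero    []       X Y = cong (X +_) (sym (+-identityʳ Y))
sumBits-select (suc p) (true ∷ u) X Y = begin
  sumBits p (λ _ → Y) + S + Y     ≡⟨ +-assoc (sumBits p (λ _ → Y)) S Y ⟩
  sumBits p (λ _ → Y) + (S + Y)   ≡⟨ cong₂ _+_ (sumBits-const p Y) (sumBits-select p u X Y) ⟩
  2 ^ p * Y + (X + 2 ^ p * Y)     ≡⟨ arith (2 ^ p) X Y ⟩
  X + 2 ^ suc p * Y               ∎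
  where
  open ≡-Reasoning
  S = sumBits p (λ cs → if eqBits cs u then X else Y)
  arith : ∀ K X Y → K * Y + (X + K * Y) ≡ X + 2 * K * Y
  arith = solve-∀
sumBits-select (suc p) (false ∷ u) X Y = begin
  S + sumBits p (λ _ → Y) + Y     ≡⟨ xy∙z≈xz∙y S _ Y ⟩
  S + Y + sumBits p (λ _ → Y)     ≡⟨ cong₂ _+_ (sumBits-select p u X Y) (sumBits-const p Y) ⟩
  X + 2 ^ p * Y + 2 ^ p * Y       ≡⟨ arith (2 ^ p) X Y ⟩
  X + 2 ^ suc p * Y               ∎
  where
  open ≡-Reasoning
  S = sumBits p (λ cs → if eqBits cs u then X else Y)
  arith : ∀ K X Y → X + K * Y + K * Y ≡ X + 2 * K * Y
  arith = solve-∀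

fewMatches : {p : ℕ} → Vec Bool p → ℕ → ℕ → ℕ
fewMatches {p} u n j = sumBelow p (2 ^ n) (λ as → ind (matches n as u <ᵇ j))

-- binomialTail r n j = Σ_{i<j} C(n,i) r^(n-i): the number of words in
-- {0,…,r}^n with fewer than j zeros
binomialTail : ℕ → ℕ → ℕ → ℕ
binomialTail r n       zero    = 0
binomialTail r zero    (suc j) = 1
binomialTail r (suc n) (suc j) = binomialTail r n j + r * binomialTail r n (suc j)

-- splitting off the lowest bit: the first column matches u for one choice of
-- the lowest bits and fails for the other 2^p - 1
fewMatches-step : {p : ℕ} (u : Vec Bool p) (n j : ℕ) →
  fewMatches u (suc n) (suc j) + fewMatches u n (suc j) ≡ fewMatches u n j + 2 ^ p * fewMatches u n (suc j)
fewMatches-step {p} u n j = begin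
  sumBelow p (2 ^ suc n) F + sumBelow p (2 ^ n) Y
    ≡⟨ cong (_+ sumBelow p (2 ^ n) Y) (trans (cong (λ m → sumBelow p m F) (2^[1+n]≡2^n*2 n))
                                             (sumBelow-double p (2 ^ n) F)) ⟩
  sumBelow p (2 ^ n) (λ as → sumBits p (λ cs → F (pushBits cs as))) + sumBelow p (2 ^ n) Y
    ≡⟨ cong (_+ sumBelow p (2 ^ n) Y) (sumBelow-cong p (2 ^ n) (λ as → sumBits-cong p (pushed as))) ⟩
  sumBelow p (2 ^ n) (λ as → sumBits p (λ cs → if eqBits cs u then X as else Y as)) + sumBelow p (2 ^ n) Y
    ≡⟨ sym (sumBelow-+ p (2 ^ n) _ Y) ⟩
  sumBelow p (2 ^ n) (λ as → sumBits p (λ cs → if eqBits cs u then X as else Y as) + Y as)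
    ≡⟨ sumBelow-cong p (2 ^ n) (λ as → sumBits-select p u (X as) (Y as)) ⟩
  sumBelow p (2 ^ n) (λ as → X as + 2 ^ p * Y as)
    ≡⟨ trans (sumBelow-+ p (2 ^ n) X _) (cong (sumBelow p (2 ^ n) X +_) (sumBelow-* p (2 ^ n) (2 ^ p) Y)) ⟩
  sumBelow p (2 ^ n) X + 2 ^ p * sumBelow p (2 ^ n) Y ∎
  where
  open ≡-Reasoning
  F X Y : Vec ℕ p → ℕ
  F as = ind (matches (suc n) as u <ᵇ suc j)
  X as = ind (matches n as u <ᵇ j)
  Y as = ind (matches n as u <ᵇ suc j)
  pushed : ∀ as cs → F (pushBits cs as) ≡ (if eqBits cs u then X as else Y as)
  pushed as cs rewrite matches-pushBits n cs as u with eqBits cs u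
  ... | true  = refl
  ... | false = refl

fewMatches≡binomialTail : {p : ℕ} (u : Vec Bool p) (r : ℕ) → 2 ^ p ≡ suc r →
  ∀ n j → fewMatches u n j ≡ binomialTail r n j
fewMatches≡binomialTail {p} u r 2^p≡1+r n zero = sumBelow-zero p (2 ^ n)
fewMatches≡binomialTail {p} u r 2^p≡1+r zero (suc j) = sumBelow-one p _
fewMatches≡binomialTail {p} u r 2^p≡1+r (suc n) (suc j) = +-cancelʳ-≡ (fewMatches u n (suc j)) _ _ (begin
  fewMatches u (suc n) (suc j) + fewMatches u n (suc j)  ≡⟨ fewMatches-step u n j ⟩
  fewMatches u n j + 2 ^ p * fewMatches u n (suc j)      ≡⟨ cong₂ (λ a b → a + 2 ^ p * b) (IH j) (IH (suc j)) ⟩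
  T j + 2 ^ p * T (suc j)                                ≡⟨ cong (λ k → T j + k * T (suc j)) 2^p≡1+r ⟩
  T j + (T (suc j) + r * T (suc j))                      ≡⟨ x∙yz≈xz∙y (T j) _ _ ⟩
  binomialTail r (suc n) (suc j) + T (suc j)             ≡⟨ cong (binomialTail r (suc n) (suc j) +_) (sym (IH (suc j))) ⟩
  binomialTail r (suc n) (suc j) + fewMatches u n (suc j) ∎)
  where
  open ≡-Reasoning
  T = binomialTail r n
  IH = fewMatches≡binomialTail u r 2^p≡1+r n

Eventually : (ℕ → Set) → Set
Eventually P = ∃[ N ] ((n : ℕ) → N ≤ n → P n)

eventually-from : (P : ℕ → Set) (N : ℕ) → P N → (∀ n → P n → P (suc n)) → Eventually P
eventually-from P N base step = N , go
  where
  go : (n : ℕ) → N ≤ n → P n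
  go n N≤n with m≤n⇒m<n∨m≡n N≤n
  go (suc n) N≤n | inj₁ (s≤s N≤n') = step n (go n N≤n')
  go n       N≤n | inj₂ refl       = base

eventually-shift : (P : ℕ → Set) (k : ℕ) → Eventually (λ m → P (m + k)) → Eventually P
eventually-shift P k (N , hyp) = N + k , λ n N+k≤n →
  subst P (m∸n+n≡m (≤-trans (m≤n+m k N) N+k≤n))
        (hyp (n ∸ k) (subst (_≤ n ∸ k) (m+n∸n≡m N k) (∸-monoˡ-≤ k N+k≤n)))

eventually-mono : {P Q : ℕ → Set} → (∀ n → P n → Q n) → Eventually P → Eventually Q
eventually-mono P⇒Q (N , p) = N , λ n N≤n → P⇒Q n (p n N≤n)

eventually-both : {P Q : ℕ → Set} → Eventually P → Eventually Q → Eventually (λ n → P n × Q n)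
eventually-both (N , p) (M , q) = N + M , λ n N+M≤n →
  p n (≤-trans (m≤m+n N M) N+M≤n) , q n (≤-trans (m≤n+m M N) N+M≤n)

binomialTail-≤ : ∀ r n j → binomialTail r n j ≤ suc r ^ n
binomialTail-≤ r n       zero    = z≤n
binomialTail-≤ r zero    (suc j) = ≤-refl
binomialTail-≤ r (suc n) (suc j) =
  +-mono-≤ (binomialTail-≤ r n j) (*-monoʳ-≤ r (binomialTail-≤ r n (suc j)))

geometric-step : ∀ r c m → c * r ^ m ≤ suc r ^ m → c * r ^ suc m ≤ suc r ^ suc m
geometric-step r c m hyp = begin
  c * (r * r ^ m)   ≡⟨ arith c r (r ^ m) ⟩
  r * (c * r ^ m)   ≤⟨ *-monoʳ-≤ r hyp ⟩
  r * suc r ^ m     ≤⟨ m≤n+m _ _ ⟩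
  suc r ^ suc m     ∎
  where
  open ≤-Reasoning
  arith : ∀ c r x → c * (r * x) ≡ r * (c * x)
  arith = solve-∀

bernoulli : ∀ r s → r ^ s * (r + s) ≤ r * suc r ^ s
bernoulli r zero = ≤-reflexive (arith r)
  where
  arith : ∀ r → 1 * (r + 0) ≡ r * 1
  arith = solve-∀
bernoulli r (suc s) = begin
  r * r ^ s * (r + suc s)           ≡⟨ arith₁ r (r ^ s) s ⟩
  r ^ s * (r * (r + suc s))         ≤⟨ *-monoʳ-≤ (r ^ s) (m≤m+n _ s) ⟩
  r ^ s * (r * (r + suc s) + s)     ≡⟨ arith₂ r (r ^ s) s ⟩
  suc r * (r ^ s * (r + s))         ≤⟨ *-monoʳ-≤ (suc r) (bernoulli r s) ⟩
  suc r * (r * suc r ^ s)           ≡⟨ arith₃ r (suc r ^ s) ⟩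
  r * (suc r * suc r ^ s)           ∎
  where
  open ≤-Reasoning
  arith₁ : ∀ r x s → r * x * (r + suc s) ≡ x * (r * (r + suc s))
  arith₁ = solve-∀
  arith₂ : ∀ r x s → x * (r * (r + suc s) + s) ≡ suc r * (x * (r + s))
  arith₂ = solve-∀
  arith₃ : ∀ r y → suc r * (r * y) ≡ r * (suc r * y)
  arith₃ = solve-∀

geometric-dominance : ∀ r c → Eventually (λ m → c * r ^ m ≤ suc r ^ m)
geometric-dominance zero     c = eventually-from _ 1 (≤-trans (≤-reflexive (*-zeroʳ c)) z≤n) (geometric-step 0 c)
geometric-dominance r@(suc _) c = eventually-from _ (c * r) base (geometric-step r c)
  where
  -- at m = c r, Bernoulli gives r^m (r + m) ≤ r (r+1)^m and r^m m = r (c r^m)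
  base : c * r ^ (c * r) ≤ suc r ^ (c * r)
  base = *-cancelˡ-≤ r (begin
    r * (c * r ^ (c * r))     ≡⟨ arith r c (r ^ (c * r)) ⟩
    r ^ (c * r) * (c * r)     ≤⟨ *-monoʳ-≤ (r ^ (c * r)) (m≤n+m (c * r) r) ⟩
    r ^ (c * r) * (r + c * r) ≤⟨ bernoulli r (c * r) ⟩
    r * suc r ^ (c * r)       ∎)
    where
    open ≤-Reasoning
    arith : ∀ r c x → r * (c * x) ≡ x * (c * r)
    arith = solve-∀

recurrence-bound : ∀ r T (x : ℕ → ℕ) → (∀ m → x (suc m) ≤ r * x m + suc r ^ m * T) →
  ∀ m → x m ≤ r ^ m * x 0 + suc r ^ m * T
recurrence-bound r T x step zero = ≤-trans (≤-reflexive (sym (*-identityˡ (x 0)))) (m≤m+n _ _)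
recurrence-bound r T x step (suc m) = begin
  x (suc m)                                      ≤⟨ step m ⟩
  r * x m + suc r ^ m * T                        ≤⟨ +-monoˡ-≤ _ (*-monoʳ-≤ r (recurrence-bound r T x step m)) ⟩
  r * (r ^ m * x 0 + suc r ^ m * T) + suc r ^ m * T ≡⟨ arith r (r ^ m) (x 0) (suc r ^ m) T ⟩
  r ^ suc m * x 0 + suc r ^ suc m * T            ∎
  where
  open ≤-Reasoning
  arith : ∀ r A x B T → r * (A * x + B * T) + B * T ≡ r * A * x + suc r * B * T
  arith = solve-∀

-- binomialTail r n j = o((r+1)^n), by induction on j: the recursion
-- x(m+1) = r x(m) + (lower order) is solved with recurrence-bound and
-- the r^m part is dominated by (r+1)^m
binomialTail-negligible : ∀ r j d → Eventually (λ n → d * binomialTail r n j ≤ suc r ^ n)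
binomialTail-negligible r zero    d = 0 , λ _ _ → ≤-trans (≤-reflexive (*-zeroʳ d)) z≤n
binomialTail-negligible r (suc j) d
  with binomialTail-negligible r j (2 * d) | geometric-dominance r (2 * d)
... | N , below | m₀ , dominated = eventually-shift _ N (m₀ , bound)
  where
  D = 2 * d
  K = suc r
  T = K ^ N
  x : ℕ → ℕ
  x m = D * binomialTail r (m + N) (suc j)
  forcing : ∀ m → x (suc m) ≤ r * x m + K ^ m * T
  forcing m = begin
    D * (binomialTail r (m + N) j + r * binomialTail r (m + N) (suc j))
      ≡⟨ arith D (binomialTail r (m + N) j) r (binomialTail r (m + N) (suc j)) ⟩
    r * x m + D * binomialTail r (m + N) j ≤⟨ +-monoʳ-≤ (r * x m) (below (m + N) (m≤n+m N m)) ⟩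
    r * x m + K ^ (m + N)                   ≡⟨ cong (r * x m +_) (^-distribˡ-+-* K m N) ⟩
    r * x m + K ^ m * T                     ∎
    where
    open ≤-Reasoning
    arith : ∀ D a r b → D * (a + r * b) ≡ r * (D * b) + D * a
    arith = solve-∀
  bound : ∀ m → m₀ ≤ m → d * binomialTail r (m + N) (suc j) ≤ K ^ (m + N)
  bound m m₀≤m = *-cancelˡ-≤ 2 (begin
    2 * (d * binomialTail r (m + N) (suc j)) ≡⟨ sym (*-assoc 2 d _) ⟩
    x m                                      ≤⟨ recurrence-bound r T x forcing m ⟩
    r ^ m * x 0 + K ^ m * T                  ≤⟨ +-monoˡ-≤ _ (*-monoʳ-≤ (r ^ m) (*-monoʳ-≤ D (binomialTail-≤ r N (suc j)))) ⟩
    r ^ m * (D * T) + K ^ m * T              ≡⟨ cong (_+ K ^ m * T) (reorder (r ^ m) D T) ⟩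
    D * r ^ m * T + K ^ m * T                ≤⟨ +-monoˡ-≤ _ (*-monoˡ-≤ T (dominated m m₀≤m)) ⟩
    K ^ m * T + K ^ m * T                    ≡⟨ arith (K ^ m * T) ⟩
    2 * (K ^ m * T)                          ≡⟨ cong (2 *_) (sym (^-distribˡ-+-* K m N)) ⟩
    2 * K ^ (m + N)                          ∎)
    where
    open ≤-Reasoning
    reorder : ∀ a D T → a * (D * T) ≡ D * a * T
    reorder = solve-∀
    arith : ∀ y → y + y ≡ 2 * y
    arith = solve-∀

length-cartesianProduct : {X Y : Set} (xs : List X) (ys : List Y) →
  length (cartesianProduct xs ys) ≡ length xs * length ys
length-cartesianProduct xs ys = begin
  length (cartesianProduct xs ys)            ≡⟨ length≡sumL (cartesianProduct xs ys) ⟩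
  sumL (λ _ → 1) (cartesianProduct xs ys)    ≡⟨ sumL-cartesianProduct _ xs ys ⟩
  sumL (λ _ → sumL (λ _ → 1) ys) xs          ≡⟨ sumL-cong (λ _ → sym (length≡sumL ys)) xs ⟩
  sumL (λ _ → length ys) xs                  ≡⟨ sumL-const _ xs ⟩
  length xs * length ys                      ∎
  where open ≡-Reasoning

length-allVA : ∀ n → length (allVA n) ≡ 2 ^ n * n
length-allVA n = trans (length-cartesianProduct (allFin (2 ^ n)) (allFin n))
                       (cong₂ _*_ (length-allFin (2 ^ n)) (length-allFin n))

vertexCount : ℕ → ℕ
vertexCount n = length (allV n)

vertexCount≡ : ∀ n → vertexCount n ≡ 2 ^ n * n + n
vertexCount≡ n = begin
  length (map inj₁ (allVA n) ++ map inj₂ (allVB n))      ≡⟨ length-++ (map inj₁ (allVA n)) ⟩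
  length (map inj₁ (allVA n)) + length (map inj₂ (allVB n))
    ≡⟨ cong₂ _+_ (length-map inj₁ (allVA n)) (length-map inj₂ (allVB n)) ⟩
  length (allVA n) + length (allFin n)                    ≡⟨ cong₂ _+_ (length-allVA n) (length-allFin n) ⟩
  2 ^ n * n + n                                           ∎
  where open ≡-Reasoning

2^n*n≤vertexCount : ∀ n → 2 ^ n * n ≤ vertexCount n
2^n*n≤vertexCount n = subst (2 ^ n * n ≤_) (sym (vertexCount≡ n)) (m≤m+n _ n)

totalTuples≡ : ∀ n p → totalTuples n p ≡ vertexCount n ^ p
totalTuples≡ n p = length-allTuples (allV n) p

sumL-allV : ∀ n (F : V n → ℕ) → sumL F (allV n) ≡ sumL (F ∘ inj₁) (allVA n) + sumL (F ∘ inj₂) (allVB n)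
sumL-allV n F = trans (sumL-++ F (map inj₁ (allVA n)) _) (cong₂ _+_ (sumL-map F inj₁ (allVA n)) (sumL-map F inj₂ (allVB n)))

inA-cons : ∀ {n p} (a : VA n) (t : Vec (V n) p) (G : Vec (VA n) (suc p) → ℕ) (z : ℕ) →
  maybe′ G z (inA (inj₁ a ∷ t)) ≡ maybe′ (G ∘ (a ∷_)) z (inA t)
inA-cons a t G z with inA t
... | just s  = refl
... | nothing = refl

sumL-restrictA : ∀ n p (G : Vec (VA n) p → ℕ) →
  sumL (λ t → maybe′ G 0 (inA t)) (allTuples (allV n) p) ≡ sumL G (allTuples (allVA n) p)
sumL-restrictA n zero    G = refl
sumL-restrictA n (suc p) G = begin
  sumL (λ t → maybe′ G 0 (inA t)) (allTuples (allV n) (suc p))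
    ≡⟨ trans (sumL-allTuples (allV n) p _) (sumL-allV n _) ⟩
  sumL (λ a → sumL (λ t → maybe′ G 0 (inA (inj₁ a ∷ t))) Tp) (allVA n) + sumL (λ b → sumL (λ _ → 0) Tp) (allVB n)
    ≡⟨ cong₂ _+_ (sumL-cong (λ a → trans (sumL-cong (λ t → inA-cons a t G 0) Tp) (sumL-restrictA n p (G ∘ (a ∷_)))) (allVA n))
                 (trans (sumL-cong (λ _ → sumL-zero Tp) (allVB n)) (sumL-zero (allVB n))) ⟩
  sumL (λ a → sumL (G ∘ (a ∷_)) (allTuples (allVA n) p)) (allVA n) + 0
    ≡⟨ trans (+-identityʳ _) (sym (sumL-allTuples (allVA n) p G)) ⟩
  sumL G (allTuples (allVA n) (suc p)) ∎
  where
  open ≡-Reasoning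
  Tp = allTuples (allV n) p

ind-∧ : ∀ x y → ind (x ∧ y) ≡ ind x * ind y
ind-∧ true  y = sym (+-identityʳ (ind y))
ind-∧ false y = refl

ind-∨ : ∀ x y → ind (x ∨ y) ≤ ind x + ind y
ind-∨ true  y = s≤s z≤n
ind-∨ false y = ≤-refl

fin-unique : ∀ m (c : Fin m) → sumL (λ i → ind (toℕ i ≡ᵇ toℕ c)) (allFin m) ≤ 1
fin-unique m c = subst (_≤ 1) (sym (sumL-allFin m (λ i → ind (i ≡ᵇ toℕ c)))) (sumN-≡ᵇ≤1 m (toℕ c))

eqVA-unique : ∀ n (y : VA n) → sumL (λ a → ind (eqVA a y)) (allVA n) ≤ 1
eqVA-unique n (c , c') = begin
  sumL (λ a → ind (eqVA a (c , c'))) (allVA n)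
    ≡⟨ sumL-cartesianProduct _ (allFin (2 ^ n)) (allFin n) ⟩
  sumL (λ a → sumL (λ a' → ind ((toℕ a ≡ᵇ toℕ c) ∧ (toℕ a' ≡ᵇ toℕ c'))) (allFin n)) (allFin (2 ^ n))
    ≡⟨ sumL-cong (λ a → trans (sumL-cong (λ a' → ind-∧ (toℕ a ≡ᵇ toℕ c) _) (allFin n))
                              (sumL-* (ind (toℕ a ≡ᵇ toℕ c)) _ (allFin n))) (allFin (2 ^ n)) ⟩
  sumL (λ a → ind (toℕ a ≡ᵇ toℕ c) * sumL (λ a' → ind (toℕ a' ≡ᵇ toℕ c')) (allFin n)) (allFin (2 ^ n))
    ≤⟨ sumL-mono (λ a → *-monoʳ-≤ (ind (toℕ a ≡ᵇ toℕ c)) (fin-unique n c')) (allFin (2 ^ n)) ⟩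
  sumL (λ a → ind (toℕ a ≡ᵇ toℕ c) * 1) (allFin (2 ^ n))
    ≡⟨ sumL-cong (λ a → *-identityʳ _) (allFin (2 ^ n)) ⟩
  sumL (λ a → ind (toℕ a ≡ᵇ toℕ c)) (allFin (2 ^ n))
    ≤⟨ fin-unique (2 ^ n) c ⟩
  1 ∎
  where open ≤-Reasoning

occursIn : ∀ {n p} → VA n → Vec (VA n) p → Bool
occursIn a s = any (eqVA a) (toList s)

occurrences-≤ : ∀ {n p} (s : Vec (VA n) p) → sumL (λ a → ind (occursIn a s)) (allVA n) ≤ p
occurrences-≤ {n} [] = ≤-reflexive (sumL-zero (allVA n))
occurrences-≤ {n} {suc p} (y ∷ s) = begin
  sumL (λ a → ind (eqVA a y ∨ occursIn a s)) (allVA n)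
    ≤⟨ sumL-mono (λ a → ind-∨ (eqVA a y) _) (allVA n) ⟩
  sumL (λ a → ind (eqVA a y) + ind (occursIn a s)) (allVA n)
    ≡⟨ sumL-+ _ _ (allVA n) ⟩
  sumL (λ a → ind (eqVA a y)) (allVA n) + sumL (λ a → ind (occursIn a s)) (allVA n)
    ≤⟨ +-mono-≤ (eqVA-unique n y) (occurrences-≤ s) ⟩
  suc p ∎
  where open ≤-Reasoning

isDegenerate : ∀ {n p} → Vec (V n) p → ℕ
isDegenerate t = maybe′ (λ s → ind (not (distinctA s))) 1 (inA t)

degenerate : ℕ → ℕ → ℕ
degenerate n p = sumL isDegenerate (allTuples (allV n) p)

occurrences : ∀ {n p} → VA n → Vec (V n) p → ℕ
occurrences a t = maybe′ (ind ∘ occursIn a) 0 (inA t)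

isDegenerate-cons : ∀ {n p} (a : VA n) (t : Vec (V n) p) →
  isDegenerate (inj₁ a ∷ t) ≤ isDegenerate t + occurrences a t
isDegenerate-cons a t with inA t
... | nothing = ≤-refl
... | just s with occursIn a s | distinctA s
...   | true  | _     = m≤n+m _ _
...   | false | true  = z≤n
...   | false | false = ≤-refl

occurrences-total : ∀ {n p} (t : Vec (V n) p) → sumL (λ a → occurrences a t) (allVA n) ≤ p
occurrences-total {n} t with inA t
... | just s  = occurrences-≤ s
... | nothing = ≤-trans (≤-reflexive (sumL-zero (allVA n))) z≤n

-- the recursion for degenerate tuples: the last entry is in B (n choices)
-- or repeats one of the p others
degenerate-step : ∀ n p →
  degenerate n (suc p) ≤ vertexCount n * degenerate n p + (p + n) * vertexCount n ^ p
degenerate-step n p = begin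
  degenerate n (suc p)
    ≡⟨ trans (sumL-allTuples (allV n) p isDegenerate) (sumL-allV n _) ⟩
  sumL (λ a → sumL (λ t → isDegenerate (inj₁ a ∷ t)) Tp) (allVA n) + sumL (λ _ → sumL (λ _ → 1) Tp) (allVB n)
    ≤⟨ +-monoˡ-≤ _ (sumL-mono (λ a → sumL-mono (isDegenerate-cons a) Tp) (allVA n)) ⟩
  sumL (λ a → sumL (λ t → isDegenerate t + occurrences a t) Tp) (allVA n) + sumL (λ _ → sumL (λ _ → 1) Tp) (allVB n)
    ≡⟨ cong₂ _+_ (trans (sumL-cong (λ a → sumL-+ isDegenerate (occurrences a) Tp) (allVA n)) (sumL-+ _ _ (allVA n)))
                 (trans (sumL-const _ (allVB n)) (cong₂ _*_ (length-allFin n) (sym (length≡sumL Tp)))) ⟩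
  sumL (λ _ → degenerate n p) (allVA n) + sumL (λ a → sumL (occurrences a) Tp) (allVA n) + n * L
    ≡⟨ cong₂ (λ x y → x + y + n * L) (sumL-const _ (allVA n)) (sumL-swap occurrences (allVA n) Tp) ⟩
  length (allVA n) * degenerate n p + sumL (λ t → sumL (λ a → occurrences a t) (allVA n)) Tp + n * L
    ≤⟨ +-monoˡ-≤ (n * L) (+-mono-≤ (*-monoˡ-≤ (degenerate n p) |A|≤M) (sumL-mono occurrences-total Tp)) ⟩
  M * degenerate n p + sumL (λ _ → p) Tp + n * L
    ≡⟨ cong (λ x → M * degenerate n p + x + n * L) (sumL-const p Tp) ⟩
  M * degenerate n p + L * p + n * L
    ≡⟨ arith (M * degenerate n p) L p n ⟩
  M * degenerate n p + (p + n) * L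
    ≡⟨ cong (λ x → M * degenerate n p + (p + n) * x) (length-allTuples (allV n) p) ⟩
  M * degenerate n p + (p + n) * M ^ p ∎
  where
  open ≤-Reasoning
  Tp = allTuples (allV n) p
  L = length Tp
  M = vertexCount n
  |A|≤M : length (allVA n) ≤ M
  |A|≤M = subst (_≤ M) (sym (length-allVA n)) (2^n*n≤vertexCount n)
  arith : ∀ x L p n → x + L * p + n * L ≡ x + (p + n) * L
  arith = solve-∀

degenerate-bound : ∀ n p → degenerate n p * vertexCount n ≤ p * (n + p) * vertexCount n ^ p
degenerate-bound n zero    = z≤n
degenerate-bound n (suc p) = begin
  degenerate n (suc p) * M                                ≤⟨ *-monoˡ-≤ M (degenerate-step n p) ⟩
  (M * degenerate n p + (p + n) * M ^ p) * M              ≡⟨ arith₁ M (degenerate n p) p n (M ^ p) ⟩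
  M * (degenerate n p * M) + (p + n) * (M * M ^ p)        ≤⟨ +-monoˡ-≤ _ (*-monoʳ-≤ M (degenerate-bound n p)) ⟩
  M * (p * (n + p) * M ^ p) + (p + n) * (M * M ^ p)       ≡⟨ arith₂ M p n (M ^ p) ⟩
  (p * (n + p) + (p + n)) * (M * M ^ p)                   ≤⟨ *-monoˡ-≤ (M * M ^ p) (≤-trans (m≤m+n _ (suc p)) (≤-reflexive (arith₃ p n))) ⟩
  suc p * (n + suc p) * (M * M ^ p)                       ∎
  where
  open ≤-Reasoning
  M = vertexCount n
  arith₁ : ∀ M c p n x → (M * c + (p + n) * x) * M ≡ M * (c * M) + (p + n) * (M * x)
  arith₁ = solve-∀
  arith₂ : ∀ M p n x → M * (p * (n + p) * x) + (p + n) * (M * x) ≡ (p * (n + p) + (p + n)) * (M * x)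
  arith₂ = solve-∀
  arith₃ : ∀ p n → p * (n + p) + (p + n) + suc p ≡ suc p * (n + suc p)
  arith₃ = solve-∀

-- The shadow
-- of s only depends on the first coordinates of its entries, and for each
-- u ∈ {0,1}^p, fewMatches counts those first coordinates with fewer than
-- ℓ columns equal to u.

firsts : ∀ {n p} → Vec (VA n) p → Vec ℕ p
firsts = Vec.map (toℕ ∘ proj₁)

columnMatches≡columnIs : ∀ {n p} (s : Vec (VA n) p) (u : Vec Bool p) (b : VB n) →
  columnMatches s u b ≡ columnIs (firsts s) u (toℕ b)
columnMatches≡columnIs []             []      b = refl
columnMatches≡columnIs ((a , _) ∷ s) (x ∷ u) b = cong (eqB (bit (toℕ a) (toℕ b)) x ∧_) (columnMatches≡columnIs s u b)

column-count : ∀ {n p} (s : Vec (VA n) p) (u : Vec Bool p) →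
  countL (columnMatches s u) (allVB n) ≡ matches n (firsts s) u
column-count {n} s u =
  trans (countL≡sumL _ (allFin n))
        (trans (sumL-cong (λ b → cong ind (columnMatches≡columnIs s u b)) (allFin n))
               (sumL-allFin n (λ b → ind (columnIs (firsts s) u b))))

ind-not-all : {X : Set} (f : X → Bool) (xs : List X) → ind (not (all f xs)) ≤ sumL (λ x → ind (not (f x))) xs
ind-not-all f []       = z≤n
ind-not-all f (x ∷ xs) with f x
... | true  = ind-not-all f xs
... | false = s≤s z≤n

ind-min-short : ∀ c ℓ → ind (not (c ⊓ ℓ ≡ᵇ ℓ)) ≤ ind (c <ᵇ ℓ)
ind-min-short zero    zero    = z≤n
ind-min-short zero    (suc ℓ) = ind≤1 _
ind-min-short (suc c) zero    = z≤n
ind-min-short (suc c) (suc ℓ) = ind-min-short c ℓ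

ind-not-full : ∀ {n p} ℓ (s : Vec (VA n) p) →
  ind (not (shadowIsFull ℓ s)) ≤ sumL (λ u → ind (matches n (firsts s) u <ᵇ ℓ)) (allTuples bools p)
ind-not-full {n} {p} ℓ s = ≤-trans (ind-not-all _ (allTuples bools p)) (sumL-mono short (allTuples bools p))
  where
  short : ∀ u → ind (not (shadowMult ℓ s u ≡ᵇ ℓ)) ≤ ind (matches n (firsts s) u <ᵇ ℓ)
  short u = subst (λ c → ind (not (shadowMult ℓ s u ≡ᵇ ℓ)) ≤ ind (c <ᵇ ℓ)) (column-count s u) (ind-min-short _ ℓ)

sumL-allVA-first : ∀ n (F : ℕ → ℕ) → sumL (F ∘ toℕ ∘ proj₁) (allVA n) ≡ n * sumN (2 ^ n) F
sumL-allVA-first n F = begin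
  sumL (F ∘ toℕ ∘ proj₁) (allVA n)                         ≡⟨ sumL-cartesianProduct _ (allFin (2 ^ n)) (allFin n) ⟩
  sumL (λ a → sumL (λ _ → F (toℕ a)) (allFin n)) (allFin (2 ^ n))
    ≡⟨ sumL-cong (λ a → trans (sumL-const _ (allFin n)) (cong (_* F (toℕ a)) (length-allFin n))) (allFin (2 ^ n)) ⟩
  sumL (λ a → n * F (toℕ a)) (allFin (2 ^ n))               ≡⟨ sumL-* n (F ∘ toℕ) (allFin (2 ^ n)) ⟩
  n * sumL (F ∘ toℕ) (allFin (2 ^ n))                       ≡⟨ cong (n *_) (sumL-allFin (2 ^ n) F) ⟩
  n * sumN (2 ^ n) F                                        ∎
  where open ≡-Reasoning

sumL-firsts : ∀ n p (H : Vec ℕ p → ℕ) → sumL (H ∘ firsts) (allTuples (allVA n) p) ≡ n ^ p * sumBelow p (2 ^ n) H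
sumL-firsts n zero    H = refl
sumL-firsts n (suc p) H = begin
  sumL (H ∘ firsts) (allTuples (allVA n) (suc p))
    ≡⟨ sumL-allTuples (allVA n) p _ ⟩
  sumL (λ x → sumL (λ t → H (toℕ (proj₁ x) ∷ firsts t)) (allTuples (allVA n) p)) (allVA n)
    ≡⟨ sumL-cong (λ x → sumL-firsts n p (H ∘ (toℕ (proj₁ x) ∷_))) (allVA n) ⟩
  sumL (λ x → n ^ p * Φ (toℕ (proj₁ x))) (allVA n)
    ≡⟨ trans (sumL-* (n ^ p) (Φ ∘ toℕ ∘ proj₁) (allVA n)) (cong (n ^ p *_) (sumL-allVA-first n Φ)) ⟩
  n ^ p * (n * sumN (2 ^ n) Φ)
    ≡⟨ arith (n ^ p) n _ ⟩
  n ^ suc p * sumBelow (suc p) (2 ^ n) H ∎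
  where
  open ≡-Reasoning
  arith : ∀ a n s → a * (n * s) ≡ n * a * s
  arith = solve-∀
  Φ : ℕ → ℕ
  Φ a = sumBelow p (2 ^ n) (H ∘ (a ∷_))

isDefective : ∀ {n p} → ℕ → Vec (V n) p → ℕ
isDefective ℓ t = maybe′ (λ s → ind (not (shadowIsFull ℓ s))) 0 (inA t)

defective : ℕ → ℕ → ℕ → ℕ
defective n p ℓ = sumL (isDefective ℓ) (allTuples (allV n) p)

-- union bound over u ∈ {0,1}^p; each u is short in n^p · binomialTail tuples
defective-bound : ∀ n p ℓ r → 2 ^ p ≡ suc r → defective n p ℓ ≤ 2 ^ p * (n ^ p * binomialTail r n ℓ)
defective-bound n p ℓ r 2^p≡1+r = begin
  defective n p ℓ                                           ≡⟨ sumL-restrictA n p _ ⟩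
  sumL (λ s → ind (not (shadowIsFull ℓ s))) Ap              ≤⟨ sumL-mono (ind-not-full ℓ) Ap ⟩
  sumL (λ s → sumL (λ u → short u (firsts s)) U) Ap         ≡⟨ sumL-swap (λ s u → short u (firsts s)) Ap U ⟩
  sumL (λ u → sumL (short u ∘ firsts) Ap) U                 ≡⟨ sumL-cong (λ u → sumL-firsts n p (short u)) U ⟩
  sumL (λ u → n ^ p * fewMatches u n ℓ) U
    ≡⟨ sumL-cong (λ u → cong (n ^ p *_) (fewMatches≡binomialTail u r 2^p≡1+r n ℓ)) U ⟩
  sumL (λ _ → n ^ p * binomialTail r n ℓ) U                 ≡⟨ sumL-const _ U ⟩
  length U * (n ^ p * binomialTail r n ℓ)                   ≡⟨ cong (_* (n ^ p * binomialTail r n ℓ)) (length-allTuples bools p) ⟩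
  2 ^ p * (n ^ p * binomialTail r n ℓ)                      ∎
  where
  open ≤-Reasoning
  Ap = allTuples (allVA n) p
  U = allTuples bools p
  short : Vec Bool p → Vec ℕ p → ℕ
  short u as = ind (matches n as u <ᵇ ℓ)

ind-not-good : ∀ {n p} ℓ (t : Vec (V n) p) → ind (not (goodTuple ℓ t)) ≤ isDegenerate t + isDefective ℓ t
ind-not-good ℓ t with inA t
... | nothing = s≤s z≤n
... | just s with distinctA s | shadowIsFull ℓ s
...   | true  | true  = z≤n
...   | true  | false = ≤-refl
...   | false | _     = s≤s z≤n

countL≤length : {X : Set} (f : X → Bool) (xs : List X) → countL f xs ≤ length xs
countL≤length f []       = z≤n
countL≤length f (x ∷ xs) with f x
... | true  = s≤s (countL≤length f xs)
... | false = m≤n⇒m≤1+n (countL≤length f xs)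

countL-not : {X : Set} (f : X → Bool) (xs : List X) → length xs ∸ countL f xs ≡ countL (not ∘ f) xs
countL-not f []       = refl
countL-not f (x ∷ xs) with f x
... | true  = countL-not f xs
... | false = trans (+-∸-assoc 1 (countL≤length f xs)) (cong suc (countL-not f xs))

bad≤degenerate+defective : ∀ n p ℓ → totalTuples n p ∸ goodTuples n p ℓ ≤ degenerate n p + defective n p ℓ
bad≤degenerate+defective n p ℓ = begin
  length T ∸ countL (goodTuple ℓ) T                          ≡⟨ countL-not (goodTuple ℓ) T ⟩
  countL (not ∘ goodTuple ℓ) T                               ≡⟨ countL≡sumL _ T ⟩
  sumL (ind ∘ not ∘ goodTuple ℓ) T                           ≤⟨ sumL-mono (ind-not-good ℓ) T ⟩
  sumL (λ t → isDegenerate t + isDefective ℓ t) T            ≡⟨ sumL-+ isDegenerate (isDefective ℓ) T ⟩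
  degenerate n p + defective n p ℓ                           ∎
  where
  open ≤-Reasoning
  T = allTuples (allV n) p

n<2^n : ∀ n → n < 2 ^ n
n<2^n zero    = s≤s z≤n
n<2^n (suc n) = begin-strict
  suc n           ≡⟨ +-comm 1 n ⟩
  n + 1           <⟨ +-mono-<-≤ (n<2^n n) (m^n>0 2 n) ⟩
  2 ^ n + 2 ^ n   ≡⟨ cong (2 ^ n +_) (sym (+-identityʳ (2 ^ n))) ⟩
  2 ^ suc n       ∎
  where open ≤-Reasoning

^-distribʳ-* : ∀ a b p → (a * b) ^ p ≡ a ^ p * b ^ p
^-distribʳ-* a b zero    = refl
^-distribʳ-* a b (suc p) = trans (cong (a * b *_) (^-distribʳ-* a b p)) (arith a b (a ^ p) (b ^ p))
  where
  arith : ∀ a b x y → a * b * (x * y) ≡ a * x * (b * y)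
  arith = solve-∀

-- degenerate tuples are eventually at most a 1/(2d) fraction, since
-- their proportion is ≤ p (n + p) / |V(H_n)|
degenerate-negligible : ∀ p d → Eventually (λ n → 2 * d * degenerate n p ≤ vertexCount n ^ p)
degenerate-negligible p d = suc Q , bound
  where
  Q = 2 * d * p * suc p
  bound : ∀ n → suc Q ≤ n → 2 * d * degenerate n p ≤ vertexCount n ^ p
  bound n Q<n = *-cancelʳ-≤ _ _ M {{>-nonZero 0<M}} (begin
    2 * d * degenerate n p * M                ≡⟨ *-assoc (2 * d) (degenerate n p) M ⟩
    2 * d * (degenerate n p * M)              ≤⟨ *-monoʳ-≤ (2 * d) (degenerate-bound n p) ⟩
    2 * d * (p * (n + p) * M ^ p)             ≡⟨ arith₁ (2 * d) p (n + p) (M ^ p) ⟩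
    2 * d * p * (n + p) * M ^ p               ≤⟨ *-monoˡ-≤ (M ^ p) small ⟩
    M * M ^ p                                 ≡⟨ *-comm M (M ^ p) ⟩
    M ^ p * M                                 ∎)
    where
    open ≤-Reasoning
    M = vertexCount n
    1≤n : 1 ≤ n
    1≤n = ≤-trans (s≤s z≤n) Q<n
    0<M : 0 < M
    0<M = ≤-trans 1≤n (≤-trans (m≤n*m n (2 ^ n) {{m^n≢0 2 n}}) (2^n*n≤vertexCount n))
    arith₂ : ∀ D n p → D * (n + n * p) ≡ n * (D * suc p)
    arith₂ = solve-∀
    small : 2 * d * p * (n + p) ≤ M
    small = begin
      2 * d * p * (n + p)     ≤⟨ *-monoʳ-≤ (2 * d * p) (+-monoʳ-≤ n (m≤n*m p n {{>-nonZero 1≤n}})) ⟩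
      2 * d * p * (n + n * p) ≡⟨ arith₂ (2 * d * p) n p ⟩
      n * Q                   ≤⟨ *-monoʳ-≤ n (≤-trans (n≤1+n Q) (≤-trans Q<n (<⇒≤ (n<2^n n)))) ⟩
      n * 2 ^ n               ≡⟨ *-comm n (2 ^ n) ⟩
      2 ^ n * n               ≤⟨ 2^n*n≤vertexCount n ⟩
      M                       ∎
    arith₁ : ∀ D p x y → D * (p * x * y) ≡ D * p * x * y
    arith₁ = solve-∀

-- defective tuples are eventually at most a 1/(2d) fraction:
-- 2d 2^p n^p binomialTail ≤ (2^p)^n n^p = (2^n n)^p ≤ |V(H_n)|^p
defective-negligible : ∀ p ℓ d → Eventually (λ n → 2 * d * defective n p ℓ ≤ vertexCount n ^ p)
defective-negligible p ℓ d = N , bound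
  where
  r = pred (2 ^ p)
  2^p≡1+r : 2 ^ p ≡ suc r
  2^p≡1+r = sym (suc-pred (2 ^ p) {{m^n≢0 2 p}})
  tail : Eventually (λ n → 2 * d * 2 ^ p * binomialTail r n ℓ ≤ suc r ^ n)
  tail = binomialTail-negligible r ℓ (2 * d * 2 ^ p)
  N = proj₁ tail
  bound : ∀ n → N ≤ n → 2 * d * defective n p ℓ ≤ vertexCount n ^ p
  bound n N≤n = begin
    2 * d * defective n p ℓ                   ≤⟨ *-monoʳ-≤ (2 * d) (defective-bound n p ℓ r 2^p≡1+r) ⟩
    2 * d * (2 ^ p * (n ^ p * binomialTail r n ℓ))  ≡⟨ arith (2 * d) (2 ^ p) (n ^ p) (binomialTail r n ℓ) ⟩
    2 * d * 2 ^ p * binomialTail r n ℓ * n ^ p ≤⟨ *-monoˡ-≤ (n ^ p) (proj₂ tail n N≤n) ⟩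
    suc r ^ n * n ^ p                         ≡⟨ cong (λ k → k ^ n * n ^ p) (sym 2^p≡1+r) ⟩
    (2 ^ p) ^ n * n ^ p                       ≡⟨ cong (_* n ^ p) (trans (^-*-assoc 2 p n) (trans (cong (2 ^_) (*-comm p n)) (sym (^-*-assoc 2 n p)))) ⟩
    (2 ^ n) ^ p * n ^ p                       ≡⟨ sym (^-distribʳ-* (2 ^ n) n p) ⟩
    (2 ^ n * n) ^ p                           ≤⟨ ^-monoˡ-≤ p (2^n*n≤vertexCount n) ⟩
    vertexCount n ^ p                         ∎
    where
    open ≤-Reasoning
    arith : ∀ D K x y → D * (K * (x * y)) ≡ D * K * y * x
    arith = solve-∀

bad-proportion : ∀ n p ℓ d →
  2 * d * degenerate n p ≤ vertexCount n ^ p → 2 * d * defective n p ℓ ≤ vertexCount n ^ p →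
  d * (totalTuples n p ∸ goodTuples n p ℓ) ≤ totalTuples n p
bad-proportion n p ℓ d few-degenerate few-defective = *-cancelˡ-≤ 2 (begin
  2 * (d * (totalTuples n p ∸ goodTuples n p ℓ))
    ≤⟨ *-monoʳ-≤ 2 (*-monoʳ-≤ d (bad≤degenerate+defective n p ℓ)) ⟩
  2 * (d * (degenerate n p + defective n p ℓ))      ≡⟨ arith d (degenerate n p) (defective n p ℓ) ⟩
  2 * d * degenerate n p + 2 * d * defective n p ℓ  ≤⟨ +-mono-≤ few-degenerate few-defective ⟩
  vertexCount n ^ p + vertexCount n ^ p             ≡⟨ cong (vertexCount n ^ p +_) (sym (+-identityʳ _)) ⟩
  2 * vertexCount n ^ p                             ≡⟨ cong (2 *_) (sym (totalTuples≡ n p)) ⟩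
  2 * totalTuples n p                               ∎)
  where
  open ≤-Reasoning
  arith : ∀ d a b → 2 * (d * (a + b)) ≡ 2 * d * a + 2 * d * b
  arith = solve-∀

lemma9 : (p ℓ : ℕ) →
    ((n : ℕ) → ℓ ≤ n → Universal n ℓ) ×
    ((d : ℕ) → ∃[ N ] ((n : ℕ) → N ≤ n →
    d * (totalTuples n p ∸ goodTuples n p ℓ) ≤ totalTuples n p))
lemma9 p ℓ = universal , vanishing
  where
  universal : (n : ℕ) → ℓ ≤ n → Universal n ℓ
  universal n ℓ≤n v = ≤-trans ℓ≤n (n≤rowMultiplicity n v)
  vanishing : (d : ℕ) → Eventually (λ n → d * (totalTuples n p ∸ goodTuples n p ℓ) ≤ totalTuples n p)
  vanishing d = eventually-mono (λ n (few-degenerate , few-defective) → bad-proportion n p ℓ d few-degenerate few-defective)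
                                (eventually-both (degenerate-negligible p d) (defective-negligible p ℓ d))
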